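{- Let $a,d$ be numbers and let $T_n(t,\alpha,\delta)$ denote the general Eulerian polynomials defined in the context. Then for every integer $n\ge 0$, $$-\frac{T_n(t,a-d,-d)}{(t-1)^{n+1}}=\sum_{j=0}^{\infty}t^j(a+jd)^n,$$ as an identity of formal power series in $t$.
   Context: For numbers $\alpha,\delta$, the general Eulerian numbers $A_{n,k}(\alpha,\delta)$, for integers $n\ge 0$ and $k$, are defined by: $A_{0,-1}(\alpha,\delta)=1$; $A_{n,k}(\alpha,\delta)=0$ whenever $k\ge n$ or $k\le -2$; and for $n\ge 1$ and $-1\le k\le n-1$, $$A_{n,k}(\alpha,\delta)=(-\alpha+(k+2)\delta)\,A_{n-1,k}(\alpha,\delta)+(\alpha+(n-k-1)\delta)\,A_{n-1,k-1}(\alpha,\delta).$$ The general Eulerian polynomials are $T_n(t,\alpha,\delta)=\sum_{k=-1}^{n-1}A_{n,k}(\alpha,\delta)\,t^{k+1}$ (so $T_0=1$). The convention $0^0=1$ is used. -}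

module Defs where

open import Level using (Level)
open import Data.Nat using (ℕ; zero; suc; _∸_; _≤?_)
open import Relation.Nullary using (yes; no)
open import Algebra.Bundles using (CommutativeRing; Semiring)
import Algebra.Definitions.RawSemiring as RSDefs

module _ {c ℓ : Level} (R : CommutativeRing c ℓ) where
  open CommutativeRing R hiding (zero)
  open RSDefs (Semiring.rawSemiring semiring) using (_×_; _^_)

  -- General Eulerian numbers with the index shifted by one:
  --   Eul α δ n i  =  A_{n,i-1}(α,δ)      (i = k + 1, so k ∈ {-1,…,n-1} ↔ i ∈ {0,…,n})
  -- A_{0,-1} = 1, A_{n,k} = 0 for k ≥ n or k ≤ -2, and for n ≥ 1, -1 ≤ k ≤ n-1:
  --   A_{n,k} = (-α+(k+2)δ) A_{n-1,k} + (α+(n-k-1)δ) A_{n-1,k-1}.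
  -- (With i = k+1: k+2 = i+1 and n-k-1 = n-i; A_{n-1,k-1} = Eul (n-1) (i-1), which is A_{n-1,-2} = 0 when i = 0.)
  Eul : Carrier → Carrier → ℕ → ℕ → Carrier
  Eul α δ zero zero = 1#
  Eul α δ zero (suc i) = 0#
  Eul α δ (suc m) i with i ≤? suc m
  ... | no _ = 0#
  ... | yes _ = ((- α) + (suc i × δ)) * Eul α δ m i
                + (α + ((suc m ∸ i) × δ)) * prev i
    where
    prev : ℕ → Carrier
    prev zero = 0#
    prev (suc j) = Eul α δ m j

  -- Formal power series in t over R: coefficient sequences.
  Series : Set c
  Series = ℕ → Carrier

  sumTo : ℕ → (ℕ → Carrier) → Carrier
  sumTo zero f = f zero
  sumTo (suc m) f = sumTo m f + f (suc m)

  _⋆_ : Series → Series → Series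
  (f ⋆ g) m = sumTo m (λ i → f i * g (m ∸ i))

  oneS : Series
  oneS zero = 1#
  oneS (suc _) = 0#

  tMinus1 : Series
  tMinus1 zero = - 1#
  tMinus1 (suc zero) = 1#
  tMinus1 (suc (suc _)) = 0#

  powS : Series → ℕ → Series
  powS f zero = oneS
  powS f (suc n) = f ⋆ powS f n

  -- General Eulerian polynomial T_n(t,α,δ) = Σ_{k=-1}^{n-1} A_{n,k} t^{k+1}, as a coefficient sequence
  T : Carrier → Carrier → ℕ → Series
  T α δ n i = Eul α δ n i

  negS : Series → Series
  negS f i = - f i

  _≈S_ : Series → Series → Set ℓ
  f ≈S g = ∀ i → f i ≈ g i

  rhsSeries : Carrier → Carrier → ℕ → Series
  rhsSeries a d n j = (a + (j × d)) ^ n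

-- Multiplication of a power series by t is the shift  (t·f)_i = f_{i-1}  (with f_{-1} = 0),
-- so multiplication by (t-1) is the backward difference  (Δf)_i = f_{i-1} - f_i, and
-- multiplication by (t-1)^k is Δ^k.  The series  S_n = Σ_j t^j (a+jd)^n  satisfy
-- S_{n+1} = weight S_n, where 'weight' multiplies the j-th coefficient by a + jd.
-- A discrete Leibniz rule describes how Δ^k passes through the weighting:
--     Δ^{k+1} (weight g) = weight (Δ^{k+1} g) - (k+1) d · t·(Δ^k g).
-- Applying it to g = S_n turns the identity  Δ^{n+1} S_n = -A_n  for n into the same
-- identity for n+1, because the resulting coefficient formula is exactly the defining
-- recurrence of the general Eulerian numbers A_{n,k}(a-d, -d).
module Submission where

open import Defs
open import Level using (Level)
open import Data.Nat as ℕ using (ℕ; zero; suc; _∸_; _≤_; _<_; _≤?_; s≤s)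
open import Data.Nat.Properties using (m∸n+n≡m; <⇒≱; <-trans; n<1+n; ≤-<-connex)
open import Data.Sum using ([_,_]′)
open import Data.Integer as ℤ using (ℤ; +_; -[1+_]; _⊖_; sign; ∣_∣; _◃_)
import Data.Integer.Properties as ℤ
open import Data.Sign as Sign using (Sign)
open import Data.Maybe using (map)
open import Data.Empty using (⊥-elim)
open import Algebra.Bundles using (CommutativeRing)
open import Algebra.Solver.Ring.AlmostCommutativeRing
  using (fromCommutativeRing; _-Raw-AlmostCommutative⟶_)
open import Relation.Nullary using (yes; no; dec⇒maybe)
import Relation.Binary.PropositionalEquality as ≡

module IntegerSolver {c ℓ : Level} (R : CommutativeRing c ℓ) where
  open CommutativeRing R
  open import Algebra.Properties.Ring ring
  open import Algebra.Properties.AbelianGroup +-abelianGroup using (⁻¹-∙-comm)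
  open import Algebra.Properties.CommutativeSemigroup +-commutativeSemigroup using (interchange)
  open import Algebra.Properties.Semiring.Mult semiring using (_×_; ×-homo-+; ×1-homo-*)
  open import Relation.Binary.Reasoning.Setoid setoid

  N : ℕ → Carrier
  N n = n × 1#

  ⟦_⟧ : ℤ → Carrier
  ⟦ + n ⟧ = N n
  ⟦ -[1+ n ] ⟧ = - N (suc n)

  x-0≈x : ∀ x → x - 0# ≈ x
  x-0≈x x = trans (+-congˡ -0#≈0#) (+-identityʳ x)

  [c+x]-[c+y]≈x-y : ∀ c x y → (c + x) - (c + y) ≈ x - y
  [c+x]-[c+y]≈x-y c x y = begin
    (c + x) + - (c + y)      ≈⟨ +-congˡ (⁻¹-∙-comm c y) ⟨
    (c + x) + (- c + - y)    ≈⟨ interchange c x (- c) (- y) ⟩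
    (c + - c) + (x - y)      ≈⟨ +-congʳ (-‿inverseʳ c) ⟩
    0# + (x - y)             ≈⟨ +-identityˡ _ ⟩
    x - y ∎

  ⊖-homo : ∀ m n → ⟦ m ⊖ n ⟧ ≈ N m - N n
  ⊖-homo m zero = sym (x-0≈x (N m))
  ⊖-homo zero (suc n) = sym (+-identityˡ _)
  ⊖-homo (suc m) (suc n) = begin
    ⟦ suc m ⊖ suc n ⟧  ≡⟨ ≡.cong ⟦_⟧ (ℤ.[1+m]⊖[1+n]≡m⊖n m n) ⟩
    ⟦ m ⊖ n ⟧          ≈⟨ ⊖-homo m n ⟩
    N m - N n          ≈⟨ [c+x]-[c+y]≈x-y 1# (N m) (N n) ⟨
    N (suc m) - N (suc n) ∎

  +-homo : ∀ i j → ⟦ i ℤ.+ j ⟧ ≈ ⟦ i ⟧ + ⟦ j ⟧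
  +-homo -[1+ m ] -[1+ n ] = begin
    - (1# + (1# + N (m ℕ.+ n)))  ≈⟨ -‿cong (+-congˡ (+-congˡ (×-homo-+ 1# m n))) ⟩
    - (1# + (1# + (N m + N n)))  ≈⟨ -‿cong (sym (+-assoc 1# 1# _)) ⟩
    - ((1# + 1#) + (N m + N n))  ≈⟨ -‿cong (interchange 1# 1# (N m) (N n)) ⟩
    - (N (suc m) + N (suc n))    ≈⟨ ⁻¹-∙-comm _ _ ⟨
    ⟦ -[1+ m ] ⟧ + ⟦ -[1+ n ] ⟧ ∎
  +-homo -[1+ m ] (+ n) = trans (⊖-homo n (suc m)) (+-comm _ _)
  +-homo (+ m) -[1+ n ] = ⊖-homo m (suc n)
  +-homo (+ m) (+ n) = ×-homo-+ 1# m n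

  signed : Sign → Carrier → Carrier
  signed Sign.+ x = x
  signed Sign.- x = - x

  signed-cong : ∀ s {x y} → x ≈ y → signed s x ≈ signed s y
  signed-cong Sign.+ x≈y = x≈y
  signed-cong Sign.- x≈y = -‿cong x≈y

  signed-* : ∀ s t x y → signed (s Sign.* t) (x * y) ≈ signed s x * signed t y
  signed-* Sign.- Sign.- x y = begin
    x * y          ≈⟨ -‿involutive _ ⟨
    - - (x * y)    ≈⟨ -‿cong (-‿distribˡ-* x y) ⟩
    - (- x * y)    ≈⟨ -‿distribʳ-* _ _ ⟩
    - x * - y ∎
  signed-* Sign.- Sign.+ x y = -‿distribˡ-* x y
  signed-* Sign.+ Sign.- x y = -‿distribʳ-* x y
  signed-* Sign.+ Sign.+ x y = refl

  -- multiplication is handled through the sign/absolute-value view of ℤ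
  ◃-homo : ∀ s n → ⟦ s ◃ n ⟧ ≈ signed s (N n)
  ◃-homo Sign.- zero = sym -0#≈0#
  ◃-homo Sign.+ zero = refl
  ◃-homo Sign.- (suc n) = refl
  ◃-homo Sign.+ (suc n) = refl

  signAbs-homo : ∀ i → ⟦ i ⟧ ≈ signed (sign i) (N ∣ i ∣)
  signAbs-homo (+ n) = refl
  signAbs-homo -[1+ n ] = refl

  *-homo : ∀ i j → ⟦ i ℤ.* j ⟧ ≈ ⟦ i ⟧ * ⟦ j ⟧
  *-homo i j = begin
    ⟦ i ℤ.* j ⟧                               ≈⟨ ◃-homo s (∣ i ∣ ℕ.* ∣ j ∣) ⟩
    signed s (N (∣ i ∣ ℕ.* ∣ j ∣))            ≈⟨ signed-cong s (×1-homo-* ∣ i ∣ ∣ j ∣) ⟩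
    signed s (N ∣ i ∣ * N ∣ j ∣)              ≈⟨ signed-* (sign i) (sign j) _ _ ⟩
    signed (sign i) (N ∣ i ∣) * signed (sign j) (N ∣ j ∣)
                                              ≈⟨ *-cong (signAbs-homo i) (signAbs-homo j) ⟨
    ⟦ i ⟧ * ⟦ j ⟧ ∎
    where
    s : Sign
    s = sign i Sign.* sign j

  neg-homo : ∀ i → ⟦ ℤ.- i ⟧ ≈ - ⟦ i ⟧
  neg-homo (+ zero) = sym -0#≈0#
  neg-homo (+ suc n) = refl
  neg-homo -[1+ n ] = sym (-‿involutive _)

  ℤ⟶R : ℤ.+-*-rawRing -Raw-AlmostCommutative⟶ fromCommutativeRing R
  ℤ⟶R = record
    { ⟦_⟧ = ⟦_⟧ ; +-homo = +-homo ; *-homo = *-homo ; -‿homo = neg-homo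
    ; 0-homo = refl ; 1-homo = +-identityʳ 1# }

  -- equal coefficients are recognised by deciding equality in ℤ
  open import Algebra.Solver.Ring ℤ.+-*-rawRing (fromCommutativeRing R) ℤ⟶R
    (λ i j → map (λ i≡j → reflexive (≡.cong ⟦_⟧ i≡j)) (dec⇒maybe (i ℤ.≟ j)))
    public using (solve; _:+_; _:*_; _:-_; :-_; _:=_; con)

module EulerianGeneratingFunction {c ℓ : Level} (R : CommutativeRing c ℓ) where
  open CommutativeRing R hiding (zero)
  open import Algebra.Properties.Ring ring
    using (-0#≈0#; -‿+-comm; [y-z]x≈yx-zx)
  open import Algebra.Properties.Semiring.Mult semiring using (_×_; ×-homo-+)
  open import Relation.Binary.Reasoning.Setoid setoid
  open IntegerSolver R using (solve; _:+_; _:*_; _:-_; :-_; _:=_; con; x-0≈x)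

  infixl 7 _✶_
  _✶_ : Series R → Series R → Series R
  _✶_ = _⋆_ R

  infix 4 _≋_
  _≋_ : Series R → Series R → Set ℓ
  _≋_ = _≈S_ R

  ×-neg : ∀ k x → k × (- x) ≈ - (k × x)
  ×-neg zero x = sym -0#≈0#
  ×-neg (suc k) x = trans (+-congˡ (×-neg k x)) (-‿+-comm x (k × x))

  sum-cong : ∀ m {f g} → f ≋ g → sumTo R m f ≈ sumTo R m g
  sum-cong zero f≋g = f≋g zero
  sum-cong (suc m) f≋g = +-cong (sum-cong m f≋g) (f≋g (suc m))

  sum-zero : ∀ m → sumTo R m (λ _ → 0#) ≈ 0#
  sum-zero zero = refl
  sum-zero (suc m) = trans (+-identityʳ _) (sum-zero m)

  sum-sub : ∀ m f g → sumTo R m (λ i → f i - g i) ≈ sumTo R m f - sumTo R m g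
  sum-sub zero f g = refl
  sum-sub (suc m) f g = trans (+-congʳ (sum-sub m f g))
    (solve 4 (λ A B x y → (A :- B) :+ (x :- y) := (A :+ x) :- (B :+ y)) refl _ _ _ _)

  sum-unconsˡ : ∀ m f → sumTo R (suc m) f ≈ f 0 + sumTo R m (λ i → f (suc i))
  sum-unconsˡ zero f = refl
  sum-unconsˡ (suc m) f = trans (+-congʳ (sum-unconsˡ m f)) (+-assoc _ _ _)

  shift : Series R → Series R
  shift f zero = 0#
  shift f (suc i) = f i

  Δ : Series R → Series R
  Δ f i = shift f i - f i

  Δ^ : ℕ → Series R → Series R
  Δ^ zero f = f
  Δ^ (suc k) f = Δ (Δ^ k f)

  shift-cong : ∀ {f g} → f ≋ g → shift f ≋ shift g
  shift-cong f≋g zero = refl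
  shift-cong f≋g (suc i) = f≋g i

  Δ-cong : ∀ {f g} → f ≋ g → Δ f ≋ Δ g
  Δ-cong f≋g i = +-cong (shift-cong f≋g i) (-‿cong (f≋g i))

  shift-neg : ∀ f → shift (negS R f) ≋ negS R (shift f)
  shift-neg f zero = sym -0#≈0#
  shift-neg f (suc i) = refl

  Δ-shift : ∀ f → Δ (shift f) ≋ shift (Δ f)
  Δ-shift f zero = x-0≈x 0#
  Δ-shift f (suc i) = refl

  ✶-congˡ : ∀ {f f'} g → f ≋ f' → f ✶ g ≋ f' ✶ g
  ✶-congˡ g f≋f' m = sum-cong m (λ i → *-congʳ (f≋f' i))

  oneS-✶ : ∀ g → oneS R ✶ g ≋ g
  oneS-✶ g zero = *-identityˡ _
  oneS-✶ g (suc m) = begin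
    sumTo R (suc m) (λ i → oneS R i * g (suc m ∸ i))    ≈⟨ sum-unconsˡ m _ ⟩
    1# * g (suc m) + sumTo R m (λ i → 0# * g (m ∸ i))   ≈⟨ +-cong (*-identityˡ _) (sum-cong m (λ i → zeroˡ _)) ⟩
    g (suc m) + sumTo R m (λ _ → 0#)                    ≈⟨ +-congˡ (sum-zero m) ⟩
    g (suc m) + 0#                                      ≈⟨ +-identityʳ _ ⟩
    g (suc m) ∎

  shift-✶ : ∀ f g → shift f ✶ g ≋ shift (f ✶ g)
  shift-✶ f g zero = zeroˡ _
  shift-✶ f g (suc m) = trans (sum-unconsˡ m _) (trans (+-congʳ (zeroˡ _)) (+-identityˡ _))

  Δ-✶ : ∀ f g → Δ f ✶ g ≋ Δ (f ✶ g)
  Δ-✶ f g m = begin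
    sumTo R m (λ i → (shift f i - f i) * g (m ∸ i))                 ≈⟨ sum-cong m (λ i → [y-z]x≈yx-zx _ _ _) ⟩
    sumTo R m (λ i → shift f i * g (m ∸ i) - f i * g (m ∸ i))       ≈⟨ sum-sub m _ _ ⟩
    (shift f ✶ g) m - (f ✶ g) m                                     ≈⟨ +-congʳ (shift-✶ f g m) ⟩
    Δ (f ✶ g) m ∎

  tMinus1≈Δ1 : tMinus1 R ≋ Δ (oneS R)
  tMinus1≈Δ1 zero = sym (+-identityˡ _)
  tMinus1≈Δ1 (suc zero) = sym (x-0≈x 1#)
  tMinus1≈Δ1 (suc (suc i)) = sym (x-0≈x 0#)

  powS-✶ : ∀ k g → powS R (tMinus1 R) k ✶ g ≋ Δ^ k g
  powS-✶ zero g = oneS-✶ g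
  powS-✶ (suc k) g m = begin
    ((tMinus1 R ✶ P) ✶ g) m  ≈⟨ ✶-congˡ g (tMinus1-✶ P) m ⟩
    (Δ P ✶ g) m              ≈⟨ Δ-✶ P g m ⟩
    Δ (P ✶ g) m              ≈⟨ Δ-cong (powS-✶ k g) m ⟩
    Δ^ (suc k) g m ∎
    where
    P : Series R
    P = powS R (tMinus1 R) k
    tMinus1-✶ : ∀ f → tMinus1 R ✶ f ≋ Δ f
    tMinus1-✶ f i = trans (✶-congˡ f tMinus1≈Δ1 i) (trans (Δ-✶ (oneS R) f i) (Δ-cong (oneS-✶ f) i))

  module Weighted (a d : Carrier) where

    weight : Series R → Series R
    weight g i = (a + i × d) * g i

    Δ-weight : ∀ g → Δ (weight g) ≋ (λ i → weight (Δ g) i - d * shift g i)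
    Δ-weight g zero = solve 3
      (λ a g₀ d → con (+ 0) :- (a :+ con (+ 0)) :* g₀
               := (a :+ con (+ 0)) :* (con (+ 0) :- g₀) :- d :* con (+ 0)) refl a (g 0) d
    Δ-weight g (suc j) = solve 5
      (λ a d J gⱼ gⱼ₊₁ → (a :+ J) :* gⱼ :- (a :+ (d :+ J)) :* gⱼ₊₁
                      := (a :+ (d :+ J)) :* (gⱼ :- gⱼ₊₁) :- d :* gⱼ) refl a d (j × d) (g j) (g (suc j))

    Δ-linear : ∀ u v x → Δ (λ i → u i - x * v i) ≋ (λ i → Δ u i - x * Δ v i)
    Δ-linear u v x zero = solve 3
      (λ u v x → con (+ 0) :- (u :- x :* v) := (con (+ 0) :- u) :- x :* (con (+ 0) :- v)) refl (u 0) (v 0) x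
    Δ-linear u v x (suc i) = solve 5
      (λ u v u' v' x → (u :- x :* v) :- (u' :- x :* v') := (u :- u') :- x :* (v :- v'))
      refl (u i) (v i) (u (suc i)) (v (suc i)) x

    Δ^-weight : ∀ k g → Δ^ (suc k) (weight g) ≋ (λ i → weight (Δ^ (suc k) g) i - (suc k × d) * shift (Δ^ k g) i)
    Δ^-weight zero g i = trans (Δ-weight g i) (+-congˡ (-‿cong (*-congʳ (sym (+-identityʳ d)))))
    Δ^-weight (suc k) g i = begin
      Δ (Δ^ (suc k) (weight g)) i                    ≈⟨ Δ-cong (Δ^-weight k g) i ⟩
      Δ (λ i → weight X i - κ * shift Y i) i         ≈⟨ Δ-linear (weight X) (shift Y) κ i ⟩
      Δ (weight X) i - κ * Δ (shift Y) i             ≈⟨ +-cong (Δ-weight X i) (-‿cong (*-congˡ (Δ-shift Y i))) ⟩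
      (weight (Δ X) i - d * shift X i) - κ * shift X i
        ≈⟨ solve 4 (λ p d κ q → (p :- d :* q) :- κ :* q := p :- (d :+ κ) :* q) refl (weight (Δ X) i) d κ (shift X i) ⟩
      weight (Δ X) i - (d + κ) * shift X i ∎
      where
      X Y : Series R
      X = Δ^ (suc k) g
      Y = Δ^ k g
      κ : Carrier
      κ = suc k × d

    α δ : Carrier
    α = a - d
    δ = - d

    E : ℕ → Series R
    E = Eul R α δ

    E-vanishes : ∀ m i → m < i → E m i ≈ 0#
    E-vanishes zero (suc i) _ = refl
    E-vanishes (suc m) i m<i with i ≤? suc m
    ... | yes i≤m = ⊥-elim (<⇒≱ m<i i≤m)
    ... | no _ = refl

    E-shift-vanishes : ∀ m i → suc m < i → shift (E m) i ≈ 0#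
    E-shift-vanishes m (suc j) (s≤s m<j) = E-vanishes m j m<j

    E-recurrence : ∀ m i → i ≤ suc m →
      E (suc m) i ≈ (- α + suc i × δ) * E m i + (α + (suc m ∸ i) × δ) * shift (E m) i
    E-recurrence m i i≤m with i ≤? suc m
    ... | no i≰m = ⊥-elim (i≰m i≤m)
    E-recurrence m zero i≤m | yes _ = refl
    E-recurrence m (suc j) i≤m | yes _ = refl

    -- The coefficient computation in the induction step: the Leibniz rule applied to
    -- the coefficients -e = -A_{m,i-1} and -e' = -A_{m,i-2} yields -A_{m+1,i-1}.
    step-coefficient : ∀ m i e e' → i ≤ suc m →
      (a + i × d) * (- e' - - e) - (suc (suc m) × d) * - e'
        ≈ - ((- α + suc i × δ) * e + (α + (suc m ∸ i) × δ) * e')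
    step-coefficient m i e e' i≤m = begin
      (a + I) * (- e' - - e) - (suc (suc m) × d) * - e'   ≈⟨ +-congˡ (-‿cong (*-congʳ (+-congˡ split))) ⟩
      (a + I) * (- e' - - e) - (d + (K + I)) * - e'
        ≈⟨ solve 6 (λ a d I K e e' →
             (a :+ I) :* (:- e' :- :- e) :- (d :+ (K :+ I)) :* :- e'
             := :- ((:- (a :- d) :+ (:- d :+ :- I)) :* e :+ ((a :- d) :+ :- K) :* e'))
           refl a d I K e e' ⟩
      - ((- α + (- d + - I)) * e + (α + - K) * e')
        ≈⟨ -‿cong (+-cong (*-congʳ (+-congˡ (+-congˡ (×-neg i d))))
                           (*-congʳ (+-congˡ (×-neg (suc m ∸ i) d)))) ⟨
      - ((- α + suc i × δ) * e + (α + (suc m ∸ i) × δ) * e') ∎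
      where
      I K : Carrier
      I = i × d
      K = (suc m ∸ i) × d
      split : suc m × d ≈ K + I
      split = trans (reflexive (≡.cong (_× d) (≡.sym (m∸n+n≡m i≤m)))) (×-homo-+ d (suc m ∸ i) i)

    S : ℕ → Series R
    S = rhsSeries R a d

    -- The i-th coefficient that the Leibniz rule produces for Δ^{n+2} S_{n+1}
    -- once Δ^{n+1} S_n is known to be -A_n.
    leibniz : ℕ → ℕ → Carrier
    leibniz n i = (a + i × d) * (- shift (E n) i - - E n i) - (suc (suc n) × d) * - shift (E n) i

    Δ^-S-step : ∀ n → Δ^ (suc n) (S n) ≋ negS R (E n) → Δ^ (suc (suc n)) (S (suc n)) ≋ leibniz n
    Δ^-S-step n hyp i = begin
      Δ^ (suc (suc n)) (weight (S n)) i
        ≈⟨ Δ^-weight (suc n) (S n) i ⟩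
      (a + i × d) * (shift X i - X i) - (suc (suc n) × d) * shift X i
        ≈⟨ +-cong (*-congˡ (+-cong shiftX≈ (-‿cong (hyp i)))) (-‿cong (*-congˡ shiftX≈)) ⟩
      leibniz n i ∎
      where
      X : Series R
      X = Δ^ (suc n) (S n)
      shiftX≈ : shift X i ≈ - shift (E n) i
      shiftX≈ = trans (shift-cong hyp i) (shift-neg (E n) i)

    -- These coefficients are -A_{n+1}: by the recurrence in range, and as zeros beyond it.
    leibniz≈-E : ∀ n → leibniz n ≋ negS R (E (suc n))
    leibniz≈-E n i = [ in-range , beyond-range ]′ (≤-<-connex i (suc n))
      where
      in-range : i ≤ suc n → leibniz n i ≈ - E (suc n) i
      in-range i≤n = trans (step-coefficient n i (E n i) (shift (E n) i) i≤n)
                           (-‿cong (sym (E-recurrence n i i≤n)))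
      beyond-range : suc n < i → leibniz n i ≈ - E (suc n) i
      beyond-range n<i = begin
        leibniz n i
          ≈⟨ +-cong (*-congˡ (+-cong (-‿cong e'≈0) (-‿cong (-‿cong e≈0)))) (-‿cong (*-congˡ (-‿cong e'≈0))) ⟩
        (a + i × d) * (- 0# - - 0#) - (suc (suc n) × d) * - 0#
          ≈⟨ solve 2 (λ x y → x :* (:- con (+ 0) :- :- con (+ 0)) :- y :* :- con (+ 0) := :- con (+ 0)) refl _ _ ⟩
        - 0#
          ≈⟨ -‿cong (E-vanishes (suc n) i n<i) ⟨
        - E (suc n) i ∎
        where
        e≈0 : E n i ≈ 0#
        e≈0 = E-vanishes n i (<-trans (n<1+n n) n<i)
        e'≈0 : shift (E n) i ≈ 0#
        e'≈0 = E-shift-vanishes n i n<i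

    Δ^-S : ∀ n → Δ^ (suc n) (S n) ≋ negS R (E n)
    Δ^-S zero zero = +-identityˡ _
    Δ^-S zero (suc i) = trans (-‿inverseʳ 1#) (sym -0#≈0#)
    Δ^-S (suc n) i = trans (Δ^-S-step n (Δ^-S n) i) (leibniz≈-E n i)

proposition3p4 : {c ℓ : Level} (R : CommutativeRing c ℓ) →
    let open CommutativeRing R in
    (a d : Carrier) (n : ℕ) →
    _≈S_ R (negS R (T R (a - d) (- d) n))
    (_⋆_ R (powS R (tMinus1 R) (suc n)) (rhsSeries R a d n))
proposition3p4 R a d n i = sym (begin
  (powS R (tMinus1 R) (suc n) ✶ S n) i  ≈⟨ powS-✶ (suc n) (S n) i ⟩
  Δ^ (suc n) (S n) i                    ≈⟨ Δ^-S n i ⟩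
  - E n i ∎)
  where
  open CommutativeRing R using (sym; -_)
  open EulerianGeneratingFunction R
  open Weighted a d
  open import Relation.Binary.Reasoning.Setoid (CommutativeRing.setoid R)
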